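{- Let $k\in\mathbb{N}$, $E\subseteq W(A)$ and $\vec s=(s_n(x))_{n=0}^\infty\in V^\infty(A)$ be such that $E$ is $(S,k)$-large in $\vec s$. Let $\vec w=(w_n(x))_{n=0}^\infty$ be a sequence of variable words and $(k_n)_{n=0}^\infty$, $(p_n)_{n=0}^\infty$ strictly increasing sequences in $\mathbb{N}$ with $k_0=k$, $p_0=0$, and set $F_n=[(w_i(x))_{i=0}^n\parallel(A_{k_i})_{i=0}^n]_c$; assume that for every $n\in\mathbb{N}$: (P1) $k+p_n\geq k_n$; (P2) $w_n(x)\in[(s_i(x))_{i=p_n}^{p_{n+1}-1}\parallel(A_{k+i})_{i=p_n}^{p_{n+1}-1}]_v$; (P3) $E_{F_n}$ is $(S,k_{n+1})$-large in $(w_i(x))_{i=n+1}^\infty$. Then there exist a strictly increasing sequence $(r_n)_{n=0}^\infty$ in $\mathbb{N}$ with $r_0=0$ and a sequence $\vec t=(t_n(x))_{n=0}^\infty$ of variable words such that for every $n\geq1$: (Q1) $t_n(x)\in[(w_{r_n+i}(x))_{i=0}^{r_{n+1}-r_n-1}\parallel(A_{k_{r_n+i}})_{i=0}^{r_{n+1}-r_n-1}]_v$; (Q2) for every $u\in[(t_i(x))_{i=0}^{n-1}\parallel(A_{k_{r_{i+1}-1}})_{i=0}^{n-1}]_c$ we have $u\,t_n(x)^*\in E$; (Q3) $[(t_i(x))_{i=0}^n\parallel(A_{k_{r_{i+1}-1}})_{i=0}^n]_c\subseteq F_{r_{n+1}-1}$.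
   Context: $\mathbb{N}=\{0,1,2,\dots\}$. Fix an increasing sequence $A_0\subseteq A_1\subseteq\cdots$ of nonempty finite sets and let $A=\bigcup_nA_n$. $W(A)$ is the set of finite words over $A$ (including the empty word); words are concatenated by juxtaposition. Fix a symbol $x\notin A$. A variable word is a finite word over $A\cup\{x\}$ containing $x$ at least once; $V(A)$ is the set of variable words and $V^\infty(A)$ the set of infinite sequences of variable words. For $s(x)\in V(A)$ and $a\in A\cup\{x\}$, $s(a)$ replaces every occurrence of $x$ by $a$. For variable words $(s_n(x))_{n=p}^q$ and nonempty $B_p,\dots,B_q\subseteq A$: $[(s_n(x))_{n=p}^q\parallel(B_n)_{n=p}^q]_c=\{s_p(b_p)\cdots s_q(b_q):b_n\in B_n\}$ and $[(s_n(x))_{n=p}^q\parallel(B_n)_{n=p}^q]_v=V(A)\cap\{s_p(b_p)\cdots s_q(b_q):b_n\in B_n\cup\{x\}\}$; for infinite $\vec s=(s_n(x))_{n=0}^\infty$, $[\vec s\parallel(B_n)_{n=0}^\infty]_c=\bigcup_m[(s_n(x))_{n=0}^m\parallel(B_n)_{n=0}^m]_c$. For $j\in\mathbb{N}$, a finite sequence $(t_n(x))_{n=0}^l$ is a reduced $j$-block subsequence of $\vec s$ if there are $0=m_0<\dots<m_{l+1}$ with $t_i(x)\in[(s_n(x))_{n=m_i}^{m_{i+1}-1}\parallel(A_{j+n})_{n=m_i}^{m_{i+1}-1}]_v$ for $0\le i\le l$; an infinite sequence is a reduced $j$-block subsequence if all its finite initial segments are. A tail $(w_i(x))_{i=m}^\infty$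 is regarded as the sequence $(w_{m+i}(x))_{i=0}^\infty$. For $s(x)\in V(A)$, $s(x)^*$ is the longest initial segment of $s(x)$ not containing $x$ and $s(x)^{**}$ the remaining final segment. The map $S:V^\infty(A)\to V^\infty(A)$ sends $(s_n(x))_{n=0}^\infty$ to $(u_n(x))_{n=0}^\infty$ with $u_0(x)=s_0(x)s_1(x)^*$ and $u_n(x)=s_n(x)^{**}s_{n+1}(x)^*$ for $n\ge1$. For $E\subseteq W(A)$, $E$ is $(S,j)$-large in $\vec s$ if $E\cap[S(\vec w)\parallel(A_{j+n})_{n=0}^\infty]_c\neq\emptyset$ for every infinite reduced $j$-block subsequence $\vec w$ of $\vec s$. For nonempty $E,F\subseteq W(A)$, $E_F=\{z\in W(A): wz\in E\text{ for every }w\in F\}$. -}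

module Defs where

open import Data.Nat using (ℕ; zero; suc; _+_; _∸_; _<_; _≤_)
open import Data.List using (List; []; _∷_; _++_; map)
open import Data.List.Membership.Propositional using (_∈_)
open import Data.Maybe using (Maybe; just; nothing; maybe; fromMaybe)
open import Data.Product using (Σ; ∃; _×_; _,_)
open import Relation.Binary.PropositionalEquality using (_≡_)
open import Data.Unit using (⊤)

-- Letters of variable words: `just a` is the letter a ∈ A, `nothing` is the variable x.

IsVar : {L : Set} → List (Maybe L) → Set
IsVar w = nothing ∈ w

substC : {L : Set} → List (Maybe L) → L → List L
substC s b = map (fromMaybe b) s

substV : {L : Set} → List (Maybe L) → Maybe L → List (Maybe L)
substV s m = map (maybe just m) s

star : {L : Set} → List (Maybe L) → List L
star [] = []
star (nothing ∷ _) = []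
star (just a ∷ s) = a ∷ star s

sstar : {L : Set} → List (Maybe L) → List (Maybe L)
sstar [] = []
sstar (nothing ∷ s) = nothing ∷ s
sstar (just a ∷ s) = sstar s

S : {L : Set} → (ℕ → List (Maybe L)) → ℕ → List (Maybe L)
S s zero = s 0 ++ map just (star (s 1))
S s (suc n) = sstar (s (suc n)) ++ map just (star (s (suc (suc n))))

-- InC s B p l u : u ∈ [(s_n(x))_{n=p}^{p+l-1} ∥ (B_n)_{n=p}^{p+l-1}]_c
-- (B is indexed by the absolute index n).
InC : {L : Set} → (ℕ → List (Maybe L)) → (ℕ → L → Set) → ℕ → ℕ → List L → Set
InC s B p zero u = u ≡ []
InC s B p (suc l) u =
  Σ _ λ b → B p b × Σ _ λ rest → InC s B (suc p) l rest × u ≡ substC (s p) b ++ rest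

-- Same, but with letters b_n ∈ B_n ∪ {x} (nothing = x); no V(A) restriction yet.
InVraw : {L : Set} → (ℕ → List (Maybe L)) → (ℕ → L → Set) → ℕ → ℕ → List (Maybe L) → Set
InVraw s B p zero u = u ≡ []
InVraw s B p (suc l) u =
  Σ (Maybe _) λ m → maybe (B p) ⊤ m ×
    Σ _ λ rest → InVraw s B (suc p) l rest × u ≡ substV (s p) m ++ rest

InV : {L : Set} → (ℕ → List (Maybe L)) → (ℕ → L → Set) → ℕ → ℕ → List (Maybe L) → Set
InV s B p l u = IsVar u × InVraw s B p l u

InCinf : {L : Set} → (ℕ → List (Maybe L)) → (ℕ → L → Set) → List L → Set
InCinf s B u = ∃ λ m → InC s B 0 (suc m) u

module _ {L : Set} (A : ℕ → List L) where

  Aj : ℕ → ℕ → L → Set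
  Aj j n a = a ∈ A (j + n)

  RedFin : ℕ → (ℕ → List (Maybe L)) → (ℕ → List (Maybe L)) → ℕ → Set
  RedFin j s t l = Σ (ℕ → ℕ) λ m → m 0 ≡ 0 ×
    ((i : ℕ) → i ≤ l → m i < m (suc i)) ×
    ((i : ℕ) → i ≤ l → InV s (Aj j) (m i) (m (suc i) ∸ m i) (t i))

  Red : ℕ → (ℕ → List (Maybe L)) → (ℕ → List (Maybe L)) → Set
  Red j s t = (l : ℕ) → RedFin j s t l

  Large : (List L → Set) → ℕ → (ℕ → List (Maybe L)) → Set
  Large E j s = (w : ℕ → List (Maybe L)) → Red j s w →
    Σ (List L) λ u → E u × InCinf (S w) (Aj j) u

Sub : {L : Set} → (List L → Set) → (List L → Set) → List L → Set
Sub E F z = (w : List _) → F w → E (w ++ z)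

-- Apply the largeness of E_{F_q} to the tail (w_{q+1}, w_{q+2}, …) itself, which is trivially a
-- reduced block subsequence of itself.  This yields a word of [S(w_{q+1}, …)]_c in E_{F_q}, i.e. a
-- word u₀ ∈ [(w_i)_{i=q+1}^{q+m+1}]_c followed by the constant prefix w_{q+m+2}^*.  The next block
-- t_{n+1} is then u₀ w_{q+m+2}(x) with q the last index of the previous block: its constant prefix is
-- u₀ w_{q+m+2}^*, and every word formed by the earlier blocks lies in F_q.
module Submission where

open import Defs
open import Data.Nat using (ℕ; zero; suc; _+_; _∸_; _<_; _≤_; s≤s; z≤n; _≤′_; ≤′-refl; ≤′-step)
open import Data.Nat.Properties
  using (+-suc; +-assoc; +-identityʳ; +-comm; ≤⇒≤′; ≤-reflexive; <⇒≤; n<1+n; m≤m+n;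
         m+[n∸m]≡n; m+n∸m≡n; m+n∸n≡m; module ≤-Reasoning)
open import Data.List using (List; []; _∷_; _++_; map)
open import Data.List.Properties using (map-++; map-∘; map-id; map-cong; ++-assoc; ++-identityʳ)
open import Data.List.Membership.Propositional using (_∈_)
open import Data.List.Membership.Propositional.Properties using (∈-++⁺ʳ)
open import Data.Maybe using (Maybe; just; nothing)
open import Data.Product using (Σ; ∃; _×_; _,_)
open import Data.Unit using (tt)
open import Function using (id)
open import Relation.Binary.PropositionalEquality
  using (_≡_; _≢_; refl; sym; trans; cong; subst; subst₂; module ≡-Reasoning)

module _ {L : Set} where
  open ≡-Reasoning

  substC-map-just : (u : List L) (b : L) → substC (map just u) b ≡ u
  substC-map-just u b = trans (sym (map-∘ u)) (map-id u)

  substC-star-sstar : (s : List (Maybe L)) (b : L) → substC s b ≡ star s ++ substC (sstar s) b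
  substC-star-sstar [] b = refl
  substC-star-sstar (nothing ∷ s) b = refl
  substC-star-sstar (just a ∷ s) b = cong (a ∷_) (substC-star-sstar s b)

  star-map-just-++ : (u : List L) (v : List (Maybe L)) → star (map just u ++ v) ≡ u ++ star v
  star-map-just-++ [] v = refl
  star-map-just-++ (a ∷ u) v = cong (a ∷_) (star-map-just-++ u v)

  map-just-substC : (s : List (Maybe L)) (b : L) → map just (substC s b) ≡ substV s (just b)
  map-just-substC s b = trans (sym (map-∘ s)) (map-cong (λ { nothing → refl ; (just _) → refl }) s)

  substV-nothing : (s : List (Maybe L)) → substV s nothing ≡ s
  substV-nothing s = trans (map-cong (λ { nothing → refl ; (just _) → refl }) s) (map-id s)

  substC-S-zero : (v : ℕ → List (Maybe L)) (b : L) →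
    substC (S v 0) b ≡ substC (v 0) b ++ star (v 1)
  substC-S-zero v b = begin
    substC (v 0 ++ map just (star (v 1))) b
      ≡⟨ map-++ _ (v 0) _ ⟩
    substC (v 0) b ++ substC (map just (star (v 1))) b
      ≡⟨ cong (substC (v 0) b ++_) (substC-map-just _ b) ⟩
    substC (v 0) b ++ star (v 1) ∎

  star-++-substC-S-suc : (v : ℕ → List (Maybe L)) (j : ℕ) (b : L) →
    star (v (suc j)) ++ substC (S v (suc j)) b ≡ substC (v (suc j)) b ++ star (v (suc (suc j)))
  star-++-substC-S-suc v j b = begin
    star x ++ substC (sstar x ++ map just y) b
      ≡⟨ cong (star x ++_) (map-++ _ (sstar x) _) ⟩
    star x ++ (substC (sstar x) b ++ substC (map just y) b)
      ≡⟨ cong (λ z → star x ++ (substC (sstar x) b ++ z)) (substC-map-just y b) ⟩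
    star x ++ (substC (sstar x) b ++ y)
      ≡⟨ sym (++-assoc (star x) _ y) ⟩
    (star x ++ substC (sstar x) b) ++ y
      ≡⟨ cong (_++ y) (sym (substC-star-sstar x b)) ⟩
    substC x b ++ y ∎
    where
    x = v (suc j)
    y = star (v (suc (suc j)))

  InC-single : (w : ℕ → List (Maybe L)) (B : ℕ → L → Set) (p : ℕ) (b : L) →
    B p b → InC w B p 1 (substC (w p) b)
  InC-single w B p b Bb = b , Bb , [] , refl , sym (++-identityʳ _)

  InVraw-single : (w : ℕ → List (Maybe L)) (B : ℕ → L → Set) (p : ℕ) → InVraw w B p 1 (w p)
  InVraw-single w B p =
    nothing , tt , [] , refl , sym (trans (++-identityʳ _) (substV-nothing (w p)))

  InC-++ : (w : ℕ → List (Maybe L)) (B : ℕ → L → Set) (p l l′ : ℕ) {u u′ : List L} →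
    InC w B p l u → InC w B (p + l) l′ u′ → InC w B p (l + l′) (u ++ u′)
  InC-++ w B p zero l′ refl u′∈ = subst (λ q → InC w B q l′ _) (+-identityʳ p) u′∈
  InC-++ w B p (suc l) l′ {u′ = u′} (b , Bb , rest , rest∈ , refl) u′∈ =
    b , Bb , rest ++ u′ ,
    InC-++ w B (suc p) l l′ rest∈ (subst (λ q → InC w B q l′ u′) (+-suc p l) u′∈) ,
    ++-assoc (substC (w p) b) rest u′

  InC-++-InVraw : (w : ℕ → List (Maybe L)) (B : ℕ → L → Set) (p l l′ : ℕ) {u : List L}
    {v : List (Maybe L)} →
    InC w B p l u → InVraw w B (p + l) l′ v → InVraw w B p (l + l′) (map just u ++ v)
  InC-++-InVraw w B p zero l′ refl v∈ = subst (λ q → InVraw w B q l′ _) (+-identityʳ p) v∈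
  InC-++-InVraw w B p (suc l) l′ {v = v} (b , Bb , rest , rest∈ , refl) v∈ =
    just b , Bb , map just rest ++ v ,
    InC-++-InVraw w B (suc p) l l′ rest∈ (subst (λ q → InVraw w B q l′ v) (+-suc p l) v∈) ,
    (begin
      map just (substC (w p) b ++ rest) ++ v
        ≡⟨ cong (_++ v) (map-++ just (substC (w p) b) rest) ⟩
      (map just (substC (w p) b) ++ map just rest) ++ v
        ≡⟨ ++-assoc (map just (substC (w p) b)) _ v ⟩
      map just (substC (w p) b) ++ (map just rest ++ v)
        ≡⟨ cong (_++ (map just rest ++ v)) (map-just-substC (w p) b) ⟩
      substV (w p) (just b) ++ (map just rest ++ v) ∎)

  InC-shift : (w : ℕ → List (Maybe L)) (B B′ : ℕ → L → Set) (c : ℕ) →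
    ((i : ℕ) (a : L) → B i a → B′ (c + i) a) →
    (p l : ℕ) {u : List L} → InC (λ i → w (c + i)) B p l u → InC w B′ (c + p) l u
  InC-shift w B B′ c B⊆B′ p zero u∈ = u∈
  InC-shift w B B′ c B⊆B′ p (suc l) (b , Bb , rest , rest∈ , u≡) =
    b , B⊆B′ p b Bb , rest ,
    subst (λ q → InC w B′ q l rest) (+-suc c p) (InC-shift w B B′ c B⊆B′ (suc p) l rest∈) , u≡

  InC-S-suc : (v : ℕ → List (Maybe L)) (B : ℕ → L → Set) (j l : ℕ) {u : List L} →
    InC (S v) B (suc j) l u →
    Σ (List L) λ u₀ → InC v B (suc j) l u₀ × star (v (suc j)) ++ u ≡ u₀ ++ star (v (suc j + l))
  InC-S-suc v B j zero refl =
    [] , refl , trans (++-identityʳ _) (cong (λ i → star (v i)) (sym (+-identityʳ (suc j))))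
  InC-S-suc v B j (suc l) (b , Bb , rest , rest∈ , refl)
    with InC-S-suc v B (suc j) l rest∈
  ... | u₀ , u₀∈ , rest≡ = substC (v (suc j)) b ++ u₀ , (b , Bb , u₀ , u₀∈ , refl) , (begin
    star (v (suc j)) ++ (substC (S v (suc j)) b ++ rest)
      ≡⟨ sym (++-assoc (star (v (suc j))) _ rest) ⟩
    (star (v (suc j)) ++ substC (S v (suc j)) b) ++ rest
      ≡⟨ cong (_++ rest) (star-++-substC-S-suc v j b) ⟩
    (substC (v (suc j)) b ++ star (v (suc (suc j)))) ++ rest
      ≡⟨ ++-assoc (substC (v (suc j)) b) _ rest ⟩
    substC (v (suc j)) b ++ (star (v (suc (suc j))) ++ rest)
      ≡⟨ cong (substC (v (suc j)) b ++_) rest≡ ⟩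
    substC (v (suc j)) b ++ (u₀ ++ star (v (suc (suc j) + l)))
      ≡⟨ sym (++-assoc (substC (v (suc j)) b) u₀ _) ⟩
    (substC (v (suc j)) b ++ u₀) ++ star (v (suc (suc j + l)))
      ≡⟨ cong (λ i → (substC (v (suc j)) b ++ u₀) ++ star (v i)) (sym (+-suc (suc j) l)) ⟩
    (substC (v (suc j)) b ++ u₀) ++ star (v (suc j + suc l)) ∎)

  InC-S : (v : ℕ → List (Maybe L)) (B : ℕ → L → Set) (m : ℕ) {u : List L} →
    InC (S v) B 0 (suc m) u →
    Σ (List L) λ u₀ → InC v B 0 (suc m) u₀ × u ≡ u₀ ++ star (v (suc m))
  InC-S v B m (b , Bb , rest , rest∈ , refl) with InC-S-suc v B 0 m rest∈
  ... | u₀ , u₀∈ , rest≡ = substC (v 0) b ++ u₀ , (b , Bb , u₀ , u₀∈ , refl) , (begin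
    substC (S v 0) b ++ rest
      ≡⟨ cong (_++ rest) (substC-S-zero v b) ⟩
    (substC (v 0) b ++ star (v 1)) ++ rest
      ≡⟨ ++-assoc (substC (v 0) b) _ rest ⟩
    substC (v 0) b ++ (star (v 1) ++ rest)
      ≡⟨ cong (substC (v 0) b ++_) rest≡ ⟩
    substC (v 0) b ++ (u₀ ++ star (v (suc m)))
      ≡⟨ sym (++-assoc (substC (v 0) b) u₀ _) ⟩
    (substC (v 0) b ++ u₀) ++ star (v (suc m)) ∎)

  InC-blocks : (t w : ℕ → List (Maybe L)) (Bt Bw : ℕ → L → Set) (r : ℕ → ℕ) →
    ((i : ℕ) → r i ≤ r (suc i)) →
    ((i : ℕ) (b : L) → Bt i b → InC w Bw (r i) (r (suc i) ∸ r i) (substC (t i) b)) →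
    (p l : ℕ) {u : List L} → InC t Bt p l u →
    ∃ λ l′ → r p + l′ ≡ r (p + l) × InC w Bw (r p) l′ u
  InC-blocks t w Bt Bw r r-mono block p zero refl =
    0 , trans (+-identityʳ (r p)) (cong r (sym (+-identityʳ p))) , refl
  InC-blocks t w Bt Bw r r-mono block p (suc l) (b , Bb , rest , rest∈ , refl)
    with InC-blocks t w Bt Bw r r-mono block (suc p) l rest∈
  ... | l′ , r-end , rest∈w = d + l′ , r-end′ ,
    InC-++ w Bw (r p) d l′ (block p b Bb) (subst (λ q → InC w Bw q l′ rest) (sym r-next) rest∈w)
    where
    d = r (suc p) ∸ r p
    r-next : r p + d ≡ r (suc p)
    r-next = m+[n∸m]≡n (r-mono p)
    r-end′ : r p + (d + l′) ≡ r (p + suc l)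
    r-end′ = begin
      r p + (d + l′)  ≡⟨ sym (+-assoc (r p) d l′) ⟩
      r p + d + l′    ≡⟨ cong (_+ l′) r-next ⟩
      r (suc p) + l′  ≡⟨ r-end ⟩
      r (suc p + l)   ≡⟨ cong r (sym (+-suc p l)) ⟩
      r (p + suc l)   ∎

Red-self : {L : Set} (A : ℕ → List L) (j : ℕ) (v : ℕ → List (Maybe L)) →
  ((n : ℕ) → IsVar (v n)) → Red A j v v
Red-self A j v v-var l = id , refl , (λ i _ → n<1+n i) ,
  λ i _ → subst (λ d → InV v (Aj A j) i d (v i)) (sym (m+n∸n≡m 1 i))
                (v-var i , InVraw-single v (Aj A j) i)

∈-mono : {L : Set} (A : ℕ → List L) → ((n : ℕ) (a : L) → a ∈ A n → a ∈ A (suc n)) →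
  {m n : ℕ} {a : L} → a ∈ A m → m ≤ n → a ∈ A n
∈-mono A A-step a∈ m≤n = go a∈ (≤⇒≤′ m≤n)
  where
  go : ∀ {m n a} → a ∈ A m → m ≤′ n → a ∈ A n
  go a∈ ≤′-refl = a∈
  go a∈ (≤′-step m≤′n) = A-step _ _ (go a∈ m≤′n)

+-≤-strictlyIncreasing : (f : ℕ → ℕ) → ((n : ℕ) → f n < f (suc n)) →
  (c i : ℕ) → f c + i ≤ f (c + i)
+-≤-strictlyIncreasing f f-inc c zero =
  ≤-reflexive (trans (+-identityʳ (f c)) (cong f (sym (+-identityʳ c))))
+-≤-strictlyIncreasing f f-inc c (suc i) = begin
  f c + suc i       ≡⟨ +-suc (f c) i ⟩
  suc (f c + i)     ≤⟨ s≤s (+-≤-strictlyIncreasing f f-inc c i) ⟩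
  suc (f (c + i))   ≤⟨ f-inc (c + i) ⟩
  f (suc (c + i))   ≡⟨ cong f (sym (+-suc c i)) ⟩
  f (c + suc i)     ∎
  where open ≤-Reasoning

module _ {L : Set} (A : ℕ → List L) (A-step : (n : ℕ) (a : L) → a ∈ A n → a ∈ A (suc n))
  (w : ℕ → List (Maybe L)) (w-var : (n : ℕ) → IsVar (w n))
  (kk : ℕ → ℕ) (kk-inc : (n : ℕ) → kk n < kk (suc n)) where

  Akk : ℕ → L → Set
  Akk i a = a ∈ A (kk i)

  record Extension (G : List L → Set) (q : ℕ) : Set where
    field
      gap : ℕ
      prefix : List L
      prefix-in : InC w Akk (suc q) (suc gap) prefix
      extends : G (prefix ++ star (w (suc q + suc gap)))

  extension : (G : List L → Set) (q : ℕ) →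
    Large A G (kk (suc q)) (λ i → w (suc q + i)) → Extension G q
  extension G q G-large with G-large tail (Red-self A (kk (suc q)) tail (λ i → w-var _))
    where tail = λ i → w (suc q + i)
  ... | u , Gu , m , u∈S with InC-S (λ i → w (suc q + i)) (Aj A (kk (suc q))) m u∈S
  ... | u₀ , u₀∈ , u≡ = record
    { gap = m
    ; prefix = u₀
    ; prefix-in = subst (λ p → InC w Akk p (suc m) u₀) (+-identityʳ (suc q))
        (InC-shift w (Aj A (kk (suc q))) Akk (suc q)
          (λ i a a∈ → ∈-mono A A-step a∈ (+-≤-strictlyIncreasing kk kk-inc (suc q) i)) 0 (suc m) u₀∈)
    ; extends = subst G u≡ Gu
    }

  module Construction (E : List L → Set) (ext : (q : ℕ) → Extension (Sub E (InC w Akk 0 (suc q))) q) where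
    module Ext (q : ℕ) = Extension (ext q)

    -- last n is the index in w of the final word of block n.
    last : ℕ → ℕ
    last zero = 0
    last (suc n) = suc (last n) + suc (Ext.gap (last n))

    r : ℕ → ℕ
    r zero = 0
    r (suc n) = suc (last n)

    t : ℕ → List (Maybe L)
    t zero = w 0
    t (suc n) = map just (Ext.prefix (last n)) ++ w (last (suc n))

    r-increasing : (n : ℕ) → r n < r (suc n)
    r-increasing zero = s≤s z≤n
    r-increasing (suc n) = s≤s (s≤s (m≤m+n (last n) _))

    t-var : (n : ℕ) → IsVar (t n)
    t-var zero = w-var 0
    t-var (suc n) = ∈-++⁺ʳ (map just (Ext.prefix (last n))) (w-var _)

    block-length : (n : ℕ) → r (suc (suc n)) ∸ r (suc n) ≡ suc (Ext.gap (last n)) + 1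
    block-length n = begin
      suc (last n + suc g) ∸ last n  ≡⟨ cong (_∸ last n) (sym (+-suc (last n) (suc g))) ⟩
      last n + suc (suc g) ∸ last n  ≡⟨ m+n∸m≡n (last n) (suc (suc g)) ⟩
      suc (suc g)                    ≡⟨ +-comm 1 (suc g) ⟩
      suc g + 1                      ∎
      where
      open ≡-Reasoning
      g = Ext.gap (last n)

    t-in-block : (n : ℕ) → InV w Akk (r (suc n)) (r (suc (suc n)) ∸ r (suc n)) (t (suc n))
    t-in-block n = t-var (suc n) ,
      subst (λ l → InVraw w Akk (r (suc n)) l (t (suc n))) (sym (block-length n))
        (InC-++-InVraw w Akk _ _ 1 (Ext.prefix-in (last n)) (InVraw-single w Akk (last (suc n))))

    substC-t-in-block : (i : ℕ) (b : L) → b ∈ A (kk (last i)) →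
      InC w Akk (r i) (r (suc i) ∸ r i) (substC (t i) b)
    substC-t-in-block zero b b∈ = InC-single w Akk 0 b b∈
    substC-t-in-block (suc n) b b∈ =
      subst₂ (InC w Akk (r (suc n))) (sym (block-length n)) (sym substC-t)
        (InC-++ w Akk _ _ 1 (Ext.prefix-in (last n)) (InC-single w Akk (last (suc n)) b b∈))
      where
      substC-t : substC (t (suc n)) b ≡ Ext.prefix (last n) ++ substC (w (last (suc n))) b
      substC-t = trans (map-++ _ (map just (Ext.prefix (last n))) _)
                       (cong (_++ substC (w (last (suc n))) b) (substC-map-just (Ext.prefix (last n)) b))

    Bt : ℕ → L → Set
    Bt i a = a ∈ A (kk (r (suc i) ∸ 1))

    blocks-in-F : (n : ℕ) {u : List L} → InC t Bt 0 (suc n) u → InC w Akk 0 (suc (last n)) u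
    blocks-in-F n u∈ with InC-blocks t w Bt Akk r (λ i → <⇒≤ (r-increasing i)) substC-t-in-block 0 (suc n) u∈
    ... | l′ , l′≡ , u∈w = subst (λ l → InC w Akk 0 l _) l′≡ u∈w

    star-t-extends : (n : ℕ) {u : List L} → InC t Bt 0 (suc n) u → E (u ++ star (t (suc n)))
    star-t-extends n {u} u∈ =
      subst (λ z → E (u ++ z)) (sym (star-map-just-++ (Ext.prefix (last n)) _))
        (Ext.extends (last n) u (blocks-in-F n u∈))

lemma20 : (L : Set) (A : ℕ → List L) →
    ((n : ℕ) → A n ≢ []) →
    ((n : ℕ) (a : L) → a ∈ A n → a ∈ A (suc n)) →
    ((a : L) → ∃ λ n → a ∈ A n) →
    (k : ℕ) (E : List L → Set) (s : ℕ → List (Maybe L)) →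
    ((n : ℕ) → IsVar (s n)) →
    Large A E k s →
    (w : ℕ → List (Maybe L)) → ((n : ℕ) → IsVar (w n)) →
    (kk p : ℕ → ℕ) →
    ((n : ℕ) → kk n < kk (suc n)) → ((n : ℕ) → p n < p (suc n)) →
    kk 0 ≡ k → p 0 ≡ 0 →
    let F : ℕ → List L → Set
        F n = InC w (λ i a → a ∈ A (kk i)) 0 (suc n)
    in
    ((n : ℕ) → kk n ≤ k + p n) →
    ((n : ℕ) → InV s (λ i a → a ∈ A (k + i)) (p n) (p (suc n) ∸ p n) (w n)) →
    ((n : ℕ) → Large A (Sub E (F n)) (kk (suc n)) (λ i → w (suc n + i))) →
    Σ (ℕ → ℕ) λ r → Σ (ℕ → List (Maybe L)) λ t →
      r 0 ≡ 0 × ((n : ℕ) → r n < r (suc n)) × ((n : ℕ) → IsVar (t n)) ×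
      ((n : ℕ) → 1 ≤ n →
        InV w (λ i a → a ∈ A (kk i)) (r n) (r (suc n) ∸ r n) (t n) ×
        ((u : List L) → InC t (λ i a → a ∈ A (kk (r (suc i) ∸ 1))) 0 n u →
           E (u ++ star (t n))) ×
        ((u : List L) → InC t (λ i a → a ∈ A (kk (r (suc i) ∸ 1))) 0 (suc n) u →
           F (r (suc n) ∸ 1) u))
lemma20 L A _ A-step _ k E s _ _ w w-var kk p kk-inc _ _ _ _ _ P3 =
  r , t , refl , r-increasing , t-var ,
  λ { zero ()
    ; (suc n) _ → t-in-block n , (λ _ → star-t-extends n) , (λ _ → blocks-in-F (suc n)) }
  where
  open Construction A A-step w w-var kk kk-inc E
    (λ q → extension A A-step w w-var kk kk-inc _ q (P3 q))
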